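{- Let $A$ be an abelian group of order $v\equiv 2$ or $4\pmod 6$, let $h_0\in A$ be a fixed element of order $2$, and let $\mathcal B_0$ and $\mathcal E$ be as in the context. If $(A,\mathcal B)$ is an $A$-reversible $\mathrm{SQS}(v)$ such that $\mathcal B_0\subseteq\mathcal B$, then every $B\in\mathcal B\setminus\mathcal B_0$ has its $\hat A$-orbit in $\mathcal E$.
   Context: For a finite abelian group $A$ (additive), $\hat A$ is the permutation group on $A$ generated by translations $x\mapsto x+a$ and $x\mapsto -x$; the $\hat A$-orbit of $X$ is $\{X+c\}_{c\in A}\cup\{ -X+c\}_{c\in A}$, and $[a_1,\dots,a_t]$ denotes the $\hat A$-orbit of $\{0,a_1,\dots,a_t\}$. $\mathcal E=\{[a,b,a+b]: a,b\in A,\ 0\notin\{2a,2b\},\ \{\pm a,\pm 2a\}\cap\{\pm b,\pm 2b\}=\emptyset\}$. $\Omega_1(A)=\{a: 2a=0\}$. $\mathcal Q_1=\{[a,-a,h_0]: a\in A\setminus\Omega_1(A)\}$, $\mathcal Q_2=\{[a,h,h+a]: a\in A\setminus\Omega_1(A),\ h\in\Omega_1(A)\setminus\{0,h_0\},\ 2a\ne h\}$, $\mathcal Q_3=\{[h,h',h+h']: h,h'\in\Omega_1(A)\setminus\{0\},\ h\ne h'\}$; $\mathcal B_0$ is the set of $4$-subsets of $A$ whose $\hat A$-orbit lies in $\mathcal Q_1\cup\mathcal Q_2\cup\mathcal Q_3$. An $\mathrm{SQS}(v)$ on $A$ is a family of $4$-subsets (blocks) with every $3$-subset in exactly one block; it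 is $A$-reversible if every block $B$ is symmetric ($B=-B+x$ for some $x\in A$) and the block set is $\hat A$-invariant. -}

module Defs where

open import Data.Nat using (ℕ)
open import Data.Fin using (Fin)
open import Data.Bool using (Bool; true; false; _∨_)
open import Data.List using (List; []; _∷_; length; filterᵇ; map; allFin)
open import Data.Bool.ListAction using (any)
open import Data.Product using (Σ; ∃; ∃-syntax; _×_; _,_)
open import Data.Sum using (_⊎_)
open import Relation.Nullary using (¬_; yes; no)
open import Relation.Nullary.Decidable using (⌊_⌋)
open import Relation.Binary.PropositionalEquality using (_≡_; _≢_; cong)
open import Relation.Binary.Definitions using (DecidableEquality)
open import Algebra.Structures using (IsAbelianGroup)
open import Function.Bundles using (_↔_; Inverse; _⇔_)

record FinAbGroup (v : ℕ) : Set₁ where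
  infixl 6 _+_
  field
    Carrier        : Set
    _+_            : Carrier → Carrier → Carrier
    0#             : Carrier
    -_             : Carrier → Carrier
    isAbelianGroup : IsAbelianGroup _≡_ _+_ 0# -_
    enum           : Fin v ↔ Carrier

  open Inverse enum public using (to; from; strictlyInverseˡ; strictlyInverseʳ)

  _-_ : Carrier → Carrier → Carrier
  x - y = x + (- y)

  _≟_ : DecidableEquality Carrier
  x ≟ y with Data.Fin._≟_ (from x) (from y)
  ... | yes p = yes (Relation.Binary.PropositionalEquality.trans (Relation.Binary.PropositionalEquality.sym (strictlyInverseˡ x))
                    (Relation.Binary.PropositionalEquality.trans (cong to p) (strictlyInverseˡ y)))
  ... | no ¬p = no (λ e → ¬p (cong from e))

  elements : List Carrier
  elements = map to (allFin v)

module _ {v : ℕ} (G : FinAbGroup v) where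
  open FinAbGroup G

  Subset : Set
  Subset = Carrier → Bool

  Family : Set₁
  Family = Subset → Set

  _≐_ : Subset → Subset → Set
  S ≐ T = ∀ x → S x ≡ T x

  _⊆_ : Subset → Subset → Set
  S ⊆ T = ∀ x → S x ≡ true → T x ≡ true

  ∣_∣ : Subset → ℕ
  ∣ S ∣ = length (filterᵇ S elements)

  _∈F_ : Subset → Family → Set
  S ∈F 𝓑 = ∃[ T ] (𝓑 T × T ≐ S)

  ⟪_⟫ : List Carrier → Subset
  ⟪ xs ⟫ y = any (λ x → ⌊ y ≟ x ⌋) xs

  translate : Subset → Carrier → Subset
  translate X c y = X (y - c)

  negate : Subset → Subset
  negate X y = X (- y)

  -- S lies in the Â-orbit of X:  S = X + c  or  S = -X + c
  InOrbit : Subset → Subset → Set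
  InOrbit S X = ∃[ c ] (S ≐ translate X c ⊎ S ≐ translate (negate X) c)

  SameOrbit : Subset → Subset → Set
  SameOrbit B X = ∀ S → (InOrbit S B ⇔ InOrbit S X)

  -- [a₁,…,aₜ] = Â-orbit of {0,a₁,…,aₜ};  "orbit of B equals [a₁,…,aₜ]"
  OrbitIs : Subset → List Carrier → Set
  OrbitIs B as = SameOrbit B ⟪ 0# ∷ as ⟫

  Ω₁ : Carrier → Set
  Ω₁ a = a + a ≡ 0#

  OrbitInℰ : Subset → Set
  OrbitInℰ B = ∃[ a ] ∃[ b ]
      ( a + a ≢ 0#
      × b + b ≢ 0#
      × (∀ x → ⟪ a ∷ - a ∷ (a + a) ∷ - (a + a) ∷ [] ⟫ x ≡ true
             → ⟪ b ∷ - b ∷ (b + b) ∷ - (b + b) ∷ [] ⟫ x ≡ false)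
      × OrbitIs B (a ∷ b ∷ (a + b) ∷ []))

  module _ (h₀ : Carrier) where

    InQ₁ : Subset → Set
    InQ₁ B = ∃[ a ] (¬ Ω₁ a × OrbitIs B (a ∷ - a ∷ h₀ ∷ []))

    InQ₂ : Subset → Set
    InQ₂ B = ∃[ a ] ∃[ h ]
      ( ¬ Ω₁ a × Ω₁ h × h ≢ 0# × h ≢ h₀ × a + a ≢ h
      × OrbitIs B (a ∷ h ∷ (h + a) ∷ []))

    InQ₃ : Subset → Set
    InQ₃ B = ∃[ h ] ∃[ h' ]
      ( Ω₁ h × h ≢ 0# × Ω₁ h' × h' ≢ 0# × h ≢ h'
      × OrbitIs B (h ∷ h' ∷ (h + h') ∷ []))

    ℬ₀ : Family
    ℬ₀ B = ∣ B ∣ ≡ 4 × (InQ₁ B ⊎ InQ₂ B ⊎ InQ₃ B)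

  IsSQS : Family → Set
  IsSQS 𝓑 =
      (∀ B → 𝓑 B → ∣ B ∣ ≡ 4)
    × (∀ T → ∣ T ∣ ≡ 3 → ∃[ B ] (𝓑 B × T ⊆ B))
    × (∀ T → ∣ T ∣ ≡ 3 → ∀ B B' → 𝓑 B → 𝓑 B' → T ⊆ B → T ⊆ B' → B ≐ B')

  Symmetric : Subset → Set
  Symmetric B = ∃[ x ] (B ≐ translate (negate B) x)

  IsReversibleSQS : Family → Set
  IsReversibleSQS 𝓑 =
      IsSQS 𝓑
    × (∀ B → 𝓑 B → Symmetric B)
    × (∀ B → 𝓑 B → ∀ c → translate B c ∈F 𝓑)
    × (∀ B → 𝓑 B → negate B ∈F 𝓑)

-- Since B is symmetric, σ z = x − z permutes B. If σ fixed a point c of B and moved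
-- another point z, then c, z and σ z = c − (z − c) would lie in the Q₁-block
-- c + {0, d, −d, h₀} with d = z − c; three fixed points differ by elements of Ω₁ and lie in
-- a Q₃-block. Either way B shares three points with a block of ℬ₀ ⊆ 𝓑, hence equals it,
-- contradicting B ∉ ℬ₀. So σ is fixed-point free and B = {y, y + a, y + b, y + a + b}
-- with σ exchanging y ↔ y + a + b and y + a ↔ y + b. The defining conditions of ℰ are
-- excluded the same way: 2a = 0, a = ±2b or 2a = ±2b each put three points of B into a
-- translate of a Q₁-, Q₂- or Q₃-block.

module Submission where

open import Defs
open import Data.Nat using (ℕ; _%_)
open import Data.Sum using (_⊎_)
open import Relation.Nullary using (¬_)
open import Relation.Binary.PropositionalEquality using (_≡_; _≢_)

open import Algebra.Bundles using (AbelianGroup)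
open import Algebra.Structures using (IsAbelianGroup)
open import Data.Bool.Base using (true; false)
open import Data.Bool.Properties using (T-≡; T?; ¬-not)
open import Data.Empty using (⊥; ⊥-elim)
open import Data.Fin.Base using (Fin; zero; suc)
open import Data.Integer.Base as ℤ using (ℤ; -[1+_]; _⊖_; 0ℤ)
open import Data.Integer.Properties using ([1+m]⊖[1+n]≡m⊖n)
open import Data.List.Base using (List; []; _∷_; _++_; length; map; filterᵇ)
open import Data.List.Properties using (length-++; length-map)
open import Data.List.Membership.Propositional using (_∈_)
open import Data.List.Membership.Propositional.Properties
  using (∈-map⁺; ∈-map⁻; ∈-allFin; ∈-filter⁺; ∈-filter⁻; ∈-∃++; ∈-++⁺ˡ; ∈-++⁺ʳ; ∈-++⁻)
open import Data.List.Membership.DecPropositional using (_∈?_)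
open import Data.List.Relation.Unary.All as All using (All; []; _∷_)
open import Data.List.Relation.Unary.All.Properties using (¬Any⇒All¬)
open import Data.List.Relation.Unary.AllPairs using ([]; _∷_)
open import Data.List.Relation.Unary.Any as Any using (here; there)
open import Data.List.Relation.Unary.Any.Properties using (any⁺; any⁻)
open import Data.List.Relation.Unary.Unique.Propositional using (Unique)
import Data.List.Relation.Unary.Unique.Propositional.Properties as Unique
open import Data.Nat.Base as ℕ using (zero; suc; _≤_; z≤n; s≤s)
open import Data.Nat.Properties using (+-suc; ≤-antisym; <⇒≱; ≤-reflexive)
open import Data.Product using (∃-syntax; _,_; proj₁; proj₂)
open import Data.Sum using (inj₁; inj₂)
open import Data.Vec.Base using (Vec; []; _∷_; lookup; replicate; zipWith)
import Data.Vec.Base as Vec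
open import Function.Base using (_∘_)
open import Function.Bundles using (Equivalence; mk⇔)
open import Level using (0ℓ)
open import Relation.Nullary using (Dec; yes; no)
open import Relation.Nullary.Decidable using (fromWitness; toWitness)
open import Relation.Binary.PropositionalEquality as ≡
  using (refl; cong; subst)
import Relation.Binary.Reflection
import Relation.Binary.Reasoning.Setoid as ≈-Reasoning

module AbelianGroupSolver {c ℓ} (G : AbelianGroup c ℓ) where

  open AbelianGroup G renaming (refl to ≈-refl)
  open import Algebra.Properties.AbelianGroup G
    using (ε⁻¹≈ε; ⁻¹-involutive; ⁻¹-∙-comm; x∙y⁻¹≈ε⇒x≈y; x≈y⇒x∙y⁻¹≈ε)
  open import Algebra.Properties.Monoid.Mult monoid using (×-homo-+) renaming (_×_ to _×ₙ_)
  open import Algebra.Properties.CommutativeSemigroup commutativeSemigroup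
    using (interchange)
  open ≈-Reasoning setoid

  infixl 6 _:+_ _:-_
  infix  8 :-_
  infixr 8 _·_

  data Expr (n : ℕ) : Set where
    var  : Fin n → Expr n
    :0   : Expr n
    _:+_ : Expr n → Expr n → Expr n
    :-_  : Expr n → Expr n

  _:-_ : ∀ {n} → Expr n → Expr n → Expr n
  e :- f = e :+ :- f

  ⟦_⟧ : ∀ {n} → Expr n → Vec Carrier n → Carrier
  ⟦ var i ⟧  ρ = lookup ρ i
  ⟦ :0 ⟧     ρ = ε
  ⟦ e :+ f ⟧ ρ = ⟦ e ⟧ ρ ∙ ⟦ f ⟧ ρ
  ⟦ :- e ⟧   ρ = ⟦ e ⟧ ρ ⁻¹

  _·_ : ℤ → Carrier → Carrier
  (ℤ.+ n)  · x = n ×ₙ x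
  -[1+ n ] · x = (suc n ×ₙ x) ⁻¹

  ⊖-· : ∀ m n x → (m ⊖ n) · x ≈ m ×ₙ x ∙ (n ×ₙ x) ⁻¹
  ⊖-· m       zero    x = sym (trans (∙-congˡ ε⁻¹≈ε) (identityʳ _))
  ⊖-· zero    (suc n) x = sym (identityˡ _)
  ⊖-· (suc m) (suc n) x = begin
    (suc m ⊖ suc n) · x                 ≡⟨ cong (_· x) ([1+m]⊖[1+n]≡m⊖n m n) ⟩
    (m ⊖ n) · x                         ≈⟨ ⊖-· m n x ⟩
    m ×ₙ x ∙ (n ×ₙ x) ⁻¹                  ≈⟨ identityˡ _ ⟨
    ε ∙ (m ×ₙ x ∙ (n ×ₙ x) ⁻¹)            ≈⟨ ∙-congʳ (inverseʳ x) ⟨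
    x ∙ x ⁻¹ ∙ (m ×ₙ x ∙ (n ×ₙ x) ⁻¹)     ≈⟨ interchange _ _ _ _ ⟩
    (x ∙ m ×ₙ x) ∙ (x ⁻¹ ∙ (n ×ₙ x) ⁻¹)   ≈⟨ ∙-congˡ (⁻¹-∙-comm x (n ×ₙ x)) ⟩
    (x ∙ m ×ₙ x) ∙ (x ∙ n ×ₙ x) ⁻¹        ∎

  ·-homo-+ : ∀ i j x → (i ℤ.+ j) · x ≈ i · x ∙ j · x
  ·-homo-+ (ℤ.+ m)  (ℤ.+ n)  x = ×-homo-+ x m n
  ·-homo-+ (ℤ.+ m)  -[1+ n ] x = ⊖-· m (suc n) x
  ·-homo-+ -[1+ m ] (ℤ.+ n)  x = trans (⊖-· n (suc m) x) (comm _ _)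
  ·-homo-+ -[1+ m ] -[1+ n ] x = begin
    (suc (suc (m ℕ.+ n)) ×ₙ x) ⁻¹        ≡⟨ cong (λ k → (suc k ×ₙ x) ⁻¹) (≡.sym (+-suc m n)) ⟩
    ((suc m ℕ.+ suc n) ×ₙ x) ⁻¹          ≈⟨ ⁻¹-cong (×-homo-+ x (suc m) (suc n)) ⟩
    (suc m ×ₙ x ∙ suc n ×ₙ x) ⁻¹          ≈⟨ ⁻¹-∙-comm _ _ ⟨
    (suc m ×ₙ x) ⁻¹ ∙ (suc n ×ₙ x) ⁻¹     ∎

  ·-homo-neg : ∀ i x → (ℤ.- i) · x ≈ (i · x) ⁻¹
  ·-homo-neg (ℤ.+ zero)  x = sym ε⁻¹≈ε
  ·-homo-neg (ℤ.+ suc n) x = ≈-refl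
  ·-homo-neg -[1+ n ]  x = sym (⁻¹-involutive _)

  Normal : ℕ → Set
  Normal = Vec ℤ

  ⟦_⟧⇓ : ∀ {n} → Normal n → Vec Carrier n → Carrier
  ⟦ [] ⟧⇓     []      = ε
  ⟦ k ∷ ks ⟧⇓ (x ∷ ρ) = k · x ∙ ⟦ ks ⟧⇓ ρ

  singleton : ∀ {n} → Fin n → Normal n
  singleton zero    = ℤ.+ 1 ∷ replicate _ 0ℤ
  singleton (suc i) = 0ℤ ∷ singleton i

  normalise : ∀ {n} → Expr n → Normal n
  normalise (var i)  = singleton i
  normalise :0       = replicate _ 0ℤ
  normalise (e :+ f) = zipWith ℤ._+_ (normalise e) (normalise f)
  normalise (:- e)   = Vec.map ℤ.-_ (normalise e)

  ⟦0⟧⇓ : ∀ {n} (ρ : Vec Carrier n) → ⟦ replicate n 0ℤ ⟧⇓ ρ ≈ ε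
  ⟦0⟧⇓ []      = ≈-refl
  ⟦0⟧⇓ (x ∷ ρ) = trans (identityˡ _) (⟦0⟧⇓ ρ)

  ⟦singleton⟧⇓ : ∀ {n} (i : Fin n) ρ → ⟦ singleton i ⟧⇓ ρ ≈ lookup ρ i
  ⟦singleton⟧⇓ zero    (x ∷ ρ) = trans (∙-cong (identityʳ x) (⟦0⟧⇓ ρ)) (identityʳ x)
  ⟦singleton⟧⇓ (suc i) (x ∷ ρ) = trans (identityˡ _) (⟦singleton⟧⇓ i ρ)

  ⟦+⟧⇓ : ∀ {n} (u w : Normal n) ρ → ⟦ zipWith ℤ._+_ u w ⟧⇓ ρ ≈ ⟦ u ⟧⇓ ρ ∙ ⟦ w ⟧⇓ ρ
  ⟦+⟧⇓ []      []      []      = sym (identityʳ ε)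
  ⟦+⟧⇓ (i ∷ u) (j ∷ w) (x ∷ ρ) =
    trans (∙-cong (·-homo-+ i j x) (⟦+⟧⇓ u w ρ)) (interchange _ _ _ _)

  ⟦-⟧⇓ : ∀ {n} (u : Normal n) ρ → ⟦ Vec.map ℤ.-_ u ⟧⇓ ρ ≈ ⟦ u ⟧⇓ ρ ⁻¹
  ⟦-⟧⇓ []      []      = sym ε⁻¹≈ε
  ⟦-⟧⇓ (i ∷ u) (x ∷ ρ) = trans (∙-cong (·-homo-neg i x) (⟦-⟧⇓ u ρ)) (⁻¹-∙-comm _ _)

  correct : ∀ {n} (e : Expr n) ρ → ⟦ normalise e ⟧⇓ ρ ≈ ⟦ e ⟧ ρ
  correct (var i)  ρ = ⟦singleton⟧⇓ i ρ
  correct :0       ρ = ⟦0⟧⇓ ρ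
  correct (e :+ f) ρ = trans (⟦+⟧⇓ (normalise e) (normalise f) ρ) (∙-cong (correct e ρ) (correct f ρ))
  correct (:- e)   ρ = trans (⟦-⟧⇓ (normalise e) ρ) (⁻¹-cong (correct e ρ))

  open Relation.Binary.Reflection setoid var ⟦_⟧ (λ e → ⟦ normalise e ⟧⇓) correct public
    using (solve; _⊜_)

  -- A consequence p ≈ q of hypotheses eᵢ ≈ fᵢ is proved by letting the solver
  -- check that p - q is the corresponding sum of the differences eᵢ - fᵢ.
  ≈-by-difference : ∀ {p q e f} → p ∙ q ⁻¹ ≈ e ∙ f ⁻¹ → e ≈ f → p ≈ q
  ≈-by-difference {p} {q} d e≈f = x∙y⁻¹≈ε⇒x≈y p q (trans d (x≈y⇒x∙y⁻¹≈ε e≈f))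

  ≈-by-difference₂ : ∀ {p q e f e′ f′} → p ∙ q ⁻¹ ≈ (e ∙ f ⁻¹) ∙ (e′ ∙ f′ ⁻¹) →
                     e ≈ f → e′ ≈ f′ → p ≈ q
  ≈-by-difference₂ {p} {q} d e≈f e′≈f′ = x∙y⁻¹≈ε⇒x≈y p q (begin
    p ∙ q ⁻¹                     ≈⟨ d ⟩
    (_ ∙ _ ⁻¹) ∙ (_ ∙ _ ⁻¹)      ≈⟨ ∙-cong (x≈y⇒x∙y⁻¹≈ε e≈f) (x≈y⇒x∙y⁻¹≈ε e′≈f′) ⟩
    ε ∙ ε                        ≈⟨ identityʳ ε ⟩
    ε                            ∎)

module _ {a} {A : Set a} where

  Unique⇒length≤ : ∀ {xs ys : List A} → Unique xs → (∀ {z} → z ∈ xs → z ∈ ys) →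
                   length xs ≤ length ys
  Unique⇒length≤ {[]}     _          _   = z≤n
  Unique⇒length≤ {x ∷ xs} (x∉xs ∷ u) xs⊆ys with ∈-∃++ (xs⊆ys (here refl))
  ... | us , ws , refl = subst (suc (length xs) ≤_) (≡.sym length-us++x∷ws)
                           (s≤s (Unique⇒length≤ u xs⊆us++ws))
    where
    xs⊆us++ws : ∀ {z} → z ∈ xs → z ∈ us ++ ws
    xs⊆us++ws z∈xs with ∈-++⁻ us (xs⊆ys (there z∈xs))
    ... | inj₁ z∈us         = ∈-++⁺ˡ z∈us
    ... | inj₂ (here z≡x)   = ⊥-elim (All.lookup x∉xs z∈xs (≡.sym z≡x))
    ... | inj₂ (there z∈ws) = ∈-++⁺ʳ us z∈ws
    length-us++x∷ws : length (us ++ x ∷ ws) ≡ suc (length (us ++ ws))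
    length-us++x∷ws = ≡.trans (length-++ us)
      (≡.trans (+-suc (length us) (length ws)) (cong suc (≡.sym (length-++ us))))

abelianGroup : ∀ {v} → FinAbGroup v → AbelianGroup 0ℓ 0ℓ
abelianGroup G = record
  { Carrier = Carrier ; _≈_ = _≡_ ; _∙_ = _+_ ; ε = 0# ; _⁻¹ = -_
  ; isAbelianGroup = isAbelianGroup }
  where open FinAbGroup G

module GroupFacts {v : ℕ} (G : FinAbGroup v) where

  open FinAbGroup G
  open IsAbelianGroup isAbelianGroup using (comm; identityʳ; inverseʳ)
  open AbelianGroupSolver (abelianGroup G) using (_:+_; _:-_; solve; _⊜_)
  open import Algebra.Properties.AbelianGroup (abelianGroup G)
    using (∙-cancelˡ; ⁻¹-involutive; ⁻¹-injective; ⁻¹-∙-comm; ε⁻¹≈ε; x∙y⁻¹≈ε⇒x≈y; inverseʳ-unique)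

  +-diff : ∀ p q → p + (q - p) ≡ q
  +-diff p q = solve 2 (λ p q → p :+ (q :- p) ⊜ q) refl p q

  diff≡0⇒≡ : ∀ {p q} → p - q ≡ 0# → p ≡ q
  diff≡0⇒≡ {p} {q} = x∙y⁻¹≈ε⇒x≈y p q

  x≢x+y : ∀ {x y} → y ≢ 0# → x ≢ x + y
  x≢x+y {x} {y} y≢0 x≡x+y = y≢0 (∙-cancelˡ x y 0# (≡.trans (≡.sym x≡x+y) (≡.sym (identityʳ x))))

  y≢x+y : ∀ {x y} → x ≢ 0# → y ≢ x + y
  y≢x+y {x} {y} x≢0 y≡x+y = x≢x+y x≢0 (≡.trans y≡x+y (comm x y))

  Ω₁-0 : Ω₁ G 0#
  Ω₁-0 = identityʳ 0#

  Ω₁-neg : ∀ {d} → Ω₁ G d → Ω₁ G (- d)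
  Ω₁-neg {d} Ω₁d = ≡.trans (⁻¹-∙-comm d d) (≡.trans (cong -_ Ω₁d) ε⁻¹≈ε)

  Ω₁-neg⁻ : ∀ {d} → Ω₁ G (- d) → Ω₁ G d
  Ω₁-neg⁻ {d} = subst (Ω₁ G) (⁻¹-involutive d) ∘ Ω₁-neg

  Ω₁⇒-≡ : ∀ {h} → Ω₁ G h → - h ≡ h
  Ω₁⇒-≡ {h} Ω₁h = ≡.sym (inverseʳ-unique h h Ω₁h)

  ¬Ω₁⇒≢0 : ∀ {d} → ¬ Ω₁ G d → d ≢ 0#
  ¬Ω₁⇒≢0 ¬Ω₁d d≡0 = ¬Ω₁d (subst (Ω₁ G) (≡.sym d≡0) Ω₁-0)

  ¬Ω₁⇒-≢0 : ∀ {d} → ¬ Ω₁ G d → - d ≢ 0#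
  ¬Ω₁⇒-≢0 ¬Ω₁d -d≡0 = ¬Ω₁d (Ω₁-neg⁻ (subst (Ω₁ G) (≡.sym -d≡0) Ω₁-0))

  ¬Ω₁⇒≢- : ∀ {d} → ¬ Ω₁ G d → d ≢ - d
  ¬Ω₁⇒≢- {d} ¬Ω₁d d≡-d = ¬Ω₁d (≡.trans (cong (d +_) d≡-d) (inverseʳ d))

  infix 4 _≡±_
  _≡±_ : Carrier → Carrier → Set
  u ≡± w = u ≡ w ⊎ u ≡ - w

  ≡±-link : ∀ {x u w} → x ≡± u → x ≡± w → u ≡± w
  ≡±-link (inj₁ x≡u)  (inj₁ x≡w)  = inj₁ (≡.trans (≡.sym x≡u) x≡w)
  ≡±-link (inj₁ x≡u)  (inj₂ x≡-w) = inj₂ (≡.trans (≡.sym x≡u) x≡-w)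
  ≡±-link (inj₂ x≡-u) (inj₁ x≡w)  =
    inj₂ (≡.trans (≡.sym (⁻¹-involutive _)) (cong -_ (≡.trans (≡.sym x≡-u) x≡w)))
  ≡±-link (inj₂ x≡-u) (inj₂ x≡-w) = inj₁ (⁻¹-injective (≡.trans (≡.sym x≡-u) x≡-w))

  ∈±multiples : ∀ {x a} → x ∈ (a ∷ - a ∷ (a + a) ∷ - (a + a) ∷ []) → x ≡± a ⊎ x ≡± (a + a)
  ∈±multiples (here x≡a)                         = inj₁ (inj₁ x≡a)
  ∈±multiples (there (here x≡-a))                = inj₁ (inj₂ x≡-a)
  ∈±multiples (there (there (here x≡2a)))        = inj₂ (inj₁ x≡2a)
  ∈±multiples (there (there (there (here x≡-2a)))) = inj₂ (inj₂ x≡-2a)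

module Subsets {v : ℕ} (G : FinAbGroup v) where

  open FinAbGroup G
  open IsAbelianGroup isAbelianGroup using (identityʳ)
  open AbelianGroupSolver (abelianGroup G) using (:-_; _:+_; _:-_; solve; _⊜_)

  private
    ⟪_⟫′ : List Carrier → Subset G
    ⟪_⟫′ = ⟪_⟫ G
    ∣_∣′ : Subset G → ℕ
    ∣_∣′ = ∣_∣ G
    _≐′_ : Subset G → Subset G → Set
    _≐′_ = _≐_ G

  ∈⟪⟫⁺ : ∀ {xs y} → y ∈ xs → ⟪ xs ⟫′ y ≡ true
  ∈⟪⟫⁺ y∈xs = Equivalence.to T-≡ (any⁺ _ (Any.map fromWitness y∈xs))

  ∈⟪⟫⁻ : ∀ xs {y} → ⟪ xs ⟫′ y ≡ true → y ∈ xs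
  ∈⟪⟫⁻ xs y∈⟪xs⟫ = Any.map toWitness (any⁻ _ xs (Equivalence.from T-≡ y∈⟪xs⟫))

  ≐-from-⊆ : ∀ {S T : Subset G} → (∀ x → S x ≡ true → T x ≡ true) →
             (∀ x → T x ≡ true → S x ≡ true) → S ≐′ T
  ≐-from-⊆ {S} {T} S⊆T T⊆S x with S x in Sx | T x in Tx
  ... | true  | true  = refl
  ... | false | false = refl
  ... | true  | false = ≡.trans (≡.sym (S⊆T x Sx)) Tx
  ... | false | true  = ≡.trans (≡.sym Sx) (T⊆S x Tx)

  ∈-elements : ∀ x → x ∈ elements
  ∈-elements x = subst (_∈ elements) (strictlyInverseˡ x) (∈-map⁺ to (∈-allFin (from x)))

  elements-unique : Unique elements
  elements-unique = Unique.map⁺ to-injective (Unique.allFin⁺ v)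
    where
    to-injective : ∀ {i j} → to i ≡ to j → i ≡ j
    to-injective {i} {j} e =
      ≡.trans (≡.sym (strictlyInverseʳ i)) (≡.trans (cong from e) (strictlyInverseʳ j))

  members : Subset G → List Carrier
  members S = filterᵇ S elements

  ∈-members⁺ : ∀ {S x} → S x ≡ true → x ∈ members S
  ∈-members⁺ {S} {x} Sx = ∈-filter⁺ (T? ∘ S) (∈-elements x) (Equivalence.from T-≡ Sx)

  ∈-members⁻ : ∀ {S x} → x ∈ members S → S x ≡ true
  ∈-members⁻ {S} x∈S = Equivalence.to T-≡ (proj₂ (∈-filter⁻ (T? ∘ S) {xs = elements} x∈S))

  members-unique : ∀ S → Unique (members S)
  members-unique S = Unique.filter⁺ (T? ∘ S) elements-unique

  ∣⟪⟫∣ : ∀ {xs} → Unique xs → ∣ ⟪ xs ⟫′ ∣′ ≡ length xs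
  ∣⟪⟫∣ {xs} u = ≤-antisym
    (Unique⇒length≤ (members-unique ⟪ xs ⟫′) (λ z∈S → ∈⟪⟫⁻ xs (∈-members⁻ z∈S)))
    (Unique⇒length≤ u (λ z∈xs → ∈-members⁺ {⟪ xs ⟫′} (∈⟪⟫⁺ z∈xs)))

  enumeration⇒≐⟪⟫ : ∀ S {zs} → Unique zs → length zs ≡ ∣ S ∣′ → (∀ z → z ∈ zs → S z ≡ true) → S ≐′ ⟪ zs ⟫′
  enumeration⇒≐⟪⟫ S {zs} u |zs|≡|S| zs⊆S = ≐-from-⊆ S⊆zs (λ x → zs⊆S x ∘ ∈⟪⟫⁻ zs)
    where
    S⊆zs : ∀ x → S x ≡ true → ⟪ zs ⟫′ x ≡ true
    S⊆zs x Sx with _∈?_ _≟_ x zs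
    ... | yes x∈zs = ∈⟪⟫⁺ x∈zs
    ... | no  x∉zs = ⊥-elim (<⇒≱ (≤-reflexive (cong suc (≡.sym |zs|≡|S|)))
          (Unique⇒length≤ (¬Any⇒All¬ zs x∉zs ∷ u)
            λ { (here refl) → ∈-members⁺ Sx ; (there z∈zs) → ∈-members⁺ (zs⊆S _ z∈zs) }))

  ≐-trans : ∀ {S T U} → S ≐′ T → T ≐′ U → S ≐′ U
  ≐-trans S≐T T≐U x = ≡.trans (S≐T x) (T≐U x)

  ≐-sym : ∀ {S T} → S ≐′ T → T ≐′ S
  ≐-sym S≐T x = ≡.sym (S≐T x)

  InOrbit-resp-≐ : ∀ {S X Y} → X ≐′ Y → InOrbit G S X → InOrbit G S Y
  InOrbit-resp-≐ X≐Y (c , inj₁ S≐X+c)  = c , inj₁ (λ z → ≡.trans (S≐X+c z) (X≐Y _))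
  InOrbit-resp-≐ X≐Y (c , inj₂ S≐-X+c) = c , inj₂ (λ z → ≡.trans (S≐-X+c z) (X≐Y _))

  ≐⇒SameOrbit : ∀ {X Y} → X ≐′ Y → SameOrbit G X Y
  ≐⇒SameOrbit X≐Y S = mk⇔ (InOrbit-resp-≐ X≐Y) (InOrbit-resp-≐ (≐-sym X≐Y))

  SameOrbit-trans : ∀ {X Y Z} → SameOrbit G X Y → SameOrbit G Y Z → SameOrbit G X Z
  SameOrbit-trans X~Y Y~Z S = mk⇔ (Equivalence.to (Y~Z S) ∘ Equivalence.to (X~Y S))
                                  (Equivalence.from (X~Y S) ∘ Equivalence.from (Y~Z S))

  OrbitIs-resp-≐ : ∀ {X Y} L → X ≐′ Y → OrbitIs G Y L → OrbitIs G X L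
  OrbitIs-resp-≐ {X} {Y} L X≐Y = SameOrbit-trans {X} {Y} {⟪ 0# ∷ L ⟫′} (≐⇒SameOrbit X≐Y)

  translate⇒SameOrbit : ∀ {X Y y} → X ≐′ translate G Y y → SameOrbit G X Y
  translate⇒SameOrbit {X} {Y} {y} X≐Y+y S = mk⇔ to′ from′
    where
    to′ : InOrbit G S X → InOrbit G S Y
    to′ (c , inj₁ S≐X+c) = c + y , inj₁ λ z → ≡.trans (S≐X+c z) (≡.trans (X≐Y+y _)
      (cong Y (solve 3 (λ z c y → (z :- c) :- y ⊜ z :- (c :+ y)) refl z c y)))
    to′ (c , inj₂ S≐-X+c) = c - y , inj₂ λ z → ≡.trans (S≐-X+c z) (≡.trans (X≐Y+y _)
      (cong Y (solve 3 (λ z c y → :- (z :- c) :- y ⊜ :- (z :- (c :- y))) refl z c y)))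
    from′ : InOrbit G S Y → InOrbit G S X
    from′ (c , inj₁ S≐Y+c) = c - y , inj₁ λ z → ≡.trans (S≐Y+c z) (≡.sym (≡.trans (X≐Y+y _)
      (cong Y (solve 3 (λ z c y → (z :- (c :- y)) :- y ⊜ z :- c) refl z c y))))
    from′ (c , inj₂ S≐-Y+c) = c + y , inj₂ λ z → ≡.trans (S≐-Y+c z) (≡.sym (≡.trans (X≐Y+y _)
      (cong Y (solve 3 (λ z c y → :- (z :- (c :+ y)) :- y ⊜ :- (z :- c)) refl z c y))))

  ⟪map⟫≐translate : ∀ y xs → ⟪ map (y +_) xs ⟫′ ≐′ translate G ⟪ xs ⟫′ y
  ⟪map⟫≐translate y xs = ≐-from-⊆ to′ from′
    where
    to′ : ∀ z → ⟪ map (y +_) xs ⟫′ z ≡ true → ⟪ xs ⟫′ (z - y) ≡ true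
    to′ z z∈ with ∈-map⁻ (y +_) (∈⟪⟫⁻ (map (y +_) xs) z∈)
    ... | x , x∈xs , refl =
      ∈⟪⟫⁺ (subst (_∈ xs) (solve 2 (λ y x → x ⊜ (y :+ x) :- y) refl y x) x∈xs)
    from′ : ∀ z → ⟪ xs ⟫′ (z - y) ≡ true → ⟪ map (y +_) xs ⟫′ z ≡ true
    from′ z z-y∈ = ∈⟪⟫⁺ (subst (_∈ map (y +_) xs) (solve 2 (λ z y → y :+ (z :- y) ⊜ z) refl z y)
      (∈-map⁺ (y +_) (∈⟪⟫⁻ xs z-y∈)))

  block : Carrier → List Carrier → List Carrier
  block c L = map (c +_) (0# ∷ L)

  OrbitIs-block : ∀ c L → OrbitIs G ⟪ block c L ⟫′ L
  OrbitIs-block c L = translate⇒SameOrbit {Y = ⟪ 0# ∷ L ⟫′} (⟪map⟫≐translate c (0# ∷ L))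

  ∈block₀ : ∀ {c L} → c ∈ block c L
  ∈block₀ = here (≡.sym (identityʳ _))

  module _ {p c l₁ l₂ l₃ : Carrier} where

    ∈block₁ : p ≡ c + l₁ → p ∈ block c (l₁ ∷ l₂ ∷ l₃ ∷ [])
    ∈block₁ = there ∘ here

    ∈block₂ : p ≡ c + l₂ → p ∈ block c (l₁ ∷ l₂ ∷ l₃ ∷ [])
    ∈block₂ = there ∘ there ∘ here

    ∈block₃ : p ≡ c + l₃ → p ∈ block c (l₁ ∷ l₂ ∷ l₃ ∷ [])
    ∈block₃ = there ∘ there ∘ there ∘ here

triple-determines-block : ∀ {v} (G : FinAbGroup v) {𝓑 : Family G} → IsSQS G 𝓑 →
  ∀ {B B′ p q r} → 𝓑 B → 𝓑 B′ → Unique (p ∷ q ∷ r ∷ []) →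
  All (λ z → B z ≡ true) (p ∷ q ∷ r ∷ []) → All (λ z → B′ z ≡ true) (p ∷ q ∷ r ∷ []) →
  _≐_ G B B′
triple-determines-block G (_ , _ , unique) {B} {B′} {p} {q} {r} 𝓑B 𝓑B′ u T⊆B T⊆B′ =
  unique (⟪_⟫ G (p ∷ q ∷ r ∷ [])) (∣⟪⟫∣ u) B B′ 𝓑B 𝓑B′
    (λ x x∈T → All.lookup T⊆B (∈⟪⟫⁻ _ x∈T)) (λ x x∈T → All.lookup T⊆B′ (∈⟪⟫⁻ _ x∈T))
  where open Subsets G

module Shapes {v : ℕ} (G : FinAbGroup v) (h₀ : FinAbGroup.Carrier G)
  (h₀≢0 : h₀ ≢ FinAbGroup.0# G) (Ω₁h₀ : Ω₁ G h₀) where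

  open FinAbGroup G
  open IsAbelianGroup isAbelianGroup using (comm)
  open GroupFacts G
  open import Algebra.Properties.AbelianGroup (abelianGroup G) using (inverseʳ-unique)

  InQ : Subset G → Set
  InQ S = InQ₁ G h₀ S ⊎ InQ₂ G h₀ S ⊎ InQ₃ G h₀ S

  record ℬ₀Shape (L : List Carrier) : Set where
    field
      offsets-distinct : Unique (0# ∷ L)
      three-offsets    : length L ≡ 3
      orbit-in-Q       : ∀ S → OrbitIs G S L → InQ S

  Q₁-shape : ∀ {d} → ¬ Ω₁ G d → ℬ₀Shape (d ∷ - d ∷ h₀ ∷ [])
  Q₁-shape {d} ¬Ω₁d = record
    { offsets-distinct =
        (¬Ω₁⇒≢0 ¬Ω₁d ∘ ≡.sym ∷ ¬Ω₁⇒-≢0 ¬Ω₁d ∘ ≡.sym ∷ h₀≢0 ∘ ≡.sym ∷ [])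
      ∷ (¬Ω₁⇒≢- ¬Ω₁d ∷ (λ d≡h₀ → ¬Ω₁d (subst (Ω₁ G) (≡.sym d≡h₀) Ω₁h₀)) ∷ [])
      ∷ ((λ -d≡h₀ → ¬Ω₁d (Ω₁-neg⁻ (subst (Ω₁ G) (≡.sym -d≡h₀) Ω₁h₀))) ∷ [])
      ∷ [] ∷ []
    ; three-offsets = refl
    ; orbit-in-Q = λ S o → inj₁ (d , ¬Ω₁d , o)
    }

  Q₂-shape : ∀ {a h} → ¬ Ω₁ G a → Ω₁ G h → h ≢ 0# → h ≢ h₀ → a + a ≢ h →
             ℬ₀Shape (a ∷ h ∷ (h + a) ∷ [])
  Q₂-shape {a} {h} ¬Ω₁a Ω₁h h≢0 h≢h₀ 2a≢h = record
    { offsets-distinct =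
        (a≢0 ∘ ≡.sym ∷ h≢0 ∘ ≡.sym ∷ h+a≢0 ∘ ≡.sym ∷ [])
      ∷ ((λ a≡h → ¬Ω₁a (subst (Ω₁ G) (≡.sym a≡h) Ω₁h)) ∷ (λ a≡h+a → x≢x+y h≢0 (≡.trans a≡h+a (comm h a))) ∷ [])
      ∷ (x≢x+y a≢0 ∷ [])
      ∷ [] ∷ []
    ; three-offsets = refl
    ; orbit-in-Q = λ S o → inj₂ (inj₁ (a , h , ¬Ω₁a , Ω₁h , h≢0 , h≢h₀ , 2a≢h , o))
    }
    where
    a≢0 : a ≢ 0#
    a≢0 = ¬Ω₁⇒≢0 ¬Ω₁a
    h+a≢0 : h + a ≢ 0#
    h+a≢0 h+a≡0 = ¬Ω₁a (subst (Ω₁ G) (≡.sym a≡h) Ω₁h)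
      where
      a≡h : a ≡ h
      a≡h = ≡.trans (inverseʳ-unique h a h+a≡0) (Ω₁⇒-≡ Ω₁h)

  Q₃-shape : ∀ {h h′} → Ω₁ G h → h ≢ 0# → Ω₁ G h′ → h′ ≢ 0# → h ≢ h′ →
             ℬ₀Shape (h ∷ h′ ∷ (h + h′) ∷ [])
  Q₃-shape {h} {h′} Ω₁h h≢0 Ω₁h′ h′≢0 h≢h′ = record
    { offsets-distinct =
        (h≢0 ∘ ≡.sym ∷ h′≢0 ∘ ≡.sym ∷ h+h′≢0 ∘ ≡.sym ∷ [])
      ∷ (h≢h′ ∷ x≢x+y h′≢0 ∷ [])
      ∷ (y≢x+y h≢0 ∷ [])
      ∷ [] ∷ []
    ; three-offsets = refl
    ; orbit-in-Q = λ S o → inj₂ (inj₂ (h , h′ , Ω₁h , h≢0 , Ω₁h′ , h′≢0 , h≢h′ , o))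
    }
    where
    h+h′≢0 : h + h′ ≢ 0#
    h+h′≢0 h+h′≡0 = h≢h′ (≡.sym (≡.trans (inverseʳ-unique h h′ h+h′≡0) (Ω₁⇒-≡ Ω₁h)))

module NonBaseBlock {v : ℕ} (G : FinAbGroup v) (h₀ : FinAbGroup.Carrier G)
  (h₀≢0 : h₀ ≢ FinAbGroup.0# G) (Ω₁h₀ : Ω₁ G h₀)
  (𝓑 : Family G) (reversible : IsReversibleSQS G 𝓑)
  (ℬ₀⊆𝓑 : ∀ S → ℬ₀ G h₀ S → _∈F_ G S 𝓑)
  (B : Subset G) (𝓑B : 𝓑 B) (B∉ℬ₀ : ¬ ℬ₀ G h₀ B) where

  open FinAbGroup G
  open IsAbelianGroup isAbelianGroup using (comm; identityʳ; inverseˡ)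
  open AbelianGroupSolver (abelianGroup G)
    using (:0; :-_; _:+_; _:-_; solve; _⊜_; ≈-by-difference; ≈-by-difference₂)
  open import Algebra.Properties.AbelianGroup (abelianGroup G) using (∙-cancelˡ; ∙-cancelʳ)
  open GroupFacts G
  open Subsets G
  open Shapes G h₀ h₀≢0 Ω₁h₀

  sqs : IsSQS G 𝓑
  sqs = proj₁ reversible

  ∣B∣≡4 : ∣_∣ G B ≡ 4
  ∣B∣≡4 = proj₁ sqs B 𝓑B

  InB : Carrier → Set
  InB z = B z ≡ true

  InB-resp : ∀ {p q} → p ≡ q → InB q → InB p
  InB-resp p≡q = subst InB (≡.sym p≡q)

  triangle-distinct : ∀ y {s t} → s ≢ 0# → t ≢ 0# → s ≢ t → Unique (y ∷ y + s ∷ y + t ∷ [])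
  triangle-distinct y s≢0 t≢0 s≢t =
    (x≢x+y s≢0 ∷ x≢x+y t≢0 ∷ []) ∷ ((λ e → s≢t (∙-cancelˡ y _ _ e)) ∷ []) ∷ [] ∷ []

  -- B cannot share three points with a block of ℬ₀: by the SQS axiom B would be that block.
  no-ℬ₀-triangle : ∀ {L} → ℬ₀Shape L → ∀ c y {s t} → s ≢ 0# → t ≢ 0# → s ≢ t →
                   InB y → InB (y + s) → InB (y + t) →
                   y ∈ block c L → y + s ∈ block c L → y + t ∈ block c L → ⊥
  no-ℬ₀-triangle {L} shape c y s≢0 t≢0 s≢t y∈B y+s∈B y+t∈B y∈S y+s∈S y+t∈S =
    B∉ℬ₀ (∣B∣≡4 , orbit-in-Q B (OrbitIs-resp-≐ L B≐S (OrbitIs-block c L)))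
    where
    open ℬ₀Shape shape
    S : Subset G
    S = ⟪_⟫ G (block c L)
    S∈ℬ₀ : ℬ₀ G h₀ S
    S∈ℬ₀ = ≡.trans (∣⟪⟫∣ (Unique.map⁺ (∙-cancelˡ c _ _) offsets-distinct))
                   (≡.trans (length-map (c +_) (0# ∷ L)) (cong suc three-offsets))
         , orbit-in-Q S (OrbitIs-block c L)
    B≐S : _≐_ G B S
    B≐S with ℬ₀⊆𝓑 S S∈ℬ₀
    ... | S′ , 𝓑S′ , S′≐S = ≐-trans (triple-determines-block G sqs 𝓑B 𝓑S′
          (triangle-distinct y s≢0 t≢0 s≢t) (y∈B ∷ y+s∈B ∷ y+t∈B ∷ [])
          (All.map (λ z∈S → ≡.trans (S′≐S _) (∈⟪⟫⁺ z∈S)) (y∈S ∷ y+s∈S ∷ y+t∈S ∷ [])))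
        S′≐S

  record Parallelogram (y a b : Carrier) : Set where
    field
      a≢0     : a ≢ 0#
      b≢0     : b ≢ 0#
      a≢b     : a ≢ b
      a+b≢0   : a + b ≢ 0#
      y∈B     : InB y
      y+a∈B   : InB (y + a)
      y+b∈B   : InB (y + b)
      y+a+b∈B : InB (y + (a + b))

  swap : ∀ {y a b} → Parallelogram y a b → Parallelogram y b a
  swap {y} {a} {b} P = record
    { a≢0 = b≢0 ; b≢0 = a≢0 ; a≢b = a≢b ∘ ≡.sym ; a+b≢0 = a+b≢0 ∘ ≡.trans (comm a b)
    ; y∈B = y∈B ; y+a∈B = y+b∈B ; y+b∈B = y+a∈B
    ; y+a+b∈B = InB-resp (cong (y +_) (comm b a)) y+a+b∈B }
    where open Parallelogram P

  module _ {y a b : Carrier} (P : Parallelogram y a b) where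

    open Parallelogram P

    y≡y+b-b : y ≡ (y + b) + - b
    y≡y+b-b = solve 2 (λ y b → y ⊜ (y :+ b) :- b) refl y b

    a≢2b : ¬ Ω₁ G b → a ≢ b + b
    a≢2b ¬Ω₁b a≡2b =
      no-ℬ₀-triangle (Q₁-shape ¬Ω₁b) (y + b) y a≢0 b≢0 a≢b y∈B y+a∈B y+b∈B
        (∈block₂ y≡y+b-b)
        (∈block₁ (≈-by-difference
          (solve 3 (λ y a b → (y :+ a) :- ((y :+ b) :+ b) ⊜ a :- (b :+ b)) refl y a b) a≡2b))
        (∈block₀)

    a≢-2b : ¬ Ω₁ G b → a ≢ - (b + b)
    a≢-2b ¬Ω₁b a≡-2b =
      no-ℬ₀-triangle (Q₁-shape ¬Ω₁b) y y b≢0 a+b≢0 (y≢x+y a≢0) y∈B y+b∈B y+a+b∈B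
        (∈block₀) (∈block₁ refl)
        (∈block₂ (≈-by-difference
          (solve 3 (λ y a b → (y :+ (a :+ b)) :- (y :- b) ⊜ a :- :- (b :+ b)) refl y a b) a≡-2b))

    2a≢2b : ¬ Ω₁ G b → a + a ≢ b + b
    2a≢2b ¬Ω₁b 2a≡2b with (a - b) ≟ h₀
    ... | yes a-b≡h₀ =
      no-ℬ₀-triangle (Q₁-shape ¬Ω₁b) (y + b) y a≢0 b≢0 a≢b y∈B y+a∈B y+b∈B
        (∈block₂ y≡y+b-b)
        (∈block₃ (≈-by-difference
          (solve 4 (λ y a b h → (y :+ a) :- ((y :+ b) :+ h) ⊜ (a :- b) :- h) refl y a b h₀) a-b≡h₀))
        (∈block₀)
    ... | no a-b≢h₀ with (b + b) ≟ (a - b)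
    ...   | yes 2b≡a-b = a+b≢0 (≈-by-difference₂
            (solve 2 (λ a b → (a :+ b) :- :0 ⊜ ((a :+ a) :- (b :+ b)) :+ ((b :+ b) :- (a :- b))) refl a b)
            2a≡2b 2b≡a-b)
    ...   | no 2b≢a-b =
      no-ℬ₀-triangle (Q₂-shape ¬Ω₁b Ω₁[a-b] a-b≢0 a-b≢h₀ 2b≢a-b) y y b≢0 a≢0 (a≢b ∘ ≡.sym)
        y∈B y+b∈B y+a∈B
        (∈block₀) (∈block₁ refl)
        (∈block₃ (cong (y +_) (solve 2 (λ a b → a ⊜ (a :- b) :+ b) refl a b)))
      where
      Ω₁[a-b] : Ω₁ G (a - b)
      Ω₁[a-b] = ≈-by-difference
        (solve 2 (λ a b → ((a :- b) :+ (a :- b)) :- :0 ⊜ (a :+ a) :- (b :+ b)) refl a b) 2a≡2b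
      a-b≢0 : a - b ≢ 0#
      a-b≢0 = a≢b ∘ diff≡0⇒≡

    2a≢-2b : ¬ Ω₁ G a → a + a ≢ - (b + b)
    2a≢-2b ¬Ω₁a 2a≡-2b with (a + b) ≟ h₀
    ... | yes a+b≡h₀ =
      no-ℬ₀-triangle (Q₁-shape ¬Ω₁a) y y a≢0 a+b≢0 (x≢x+y b≢0) y∈B y+a∈B y+a+b∈B
        (∈block₀) (∈block₁ refl) (∈block₃ (cong (y +_) a+b≡h₀))
    ... | no a+b≢h₀ with (a + a) ≟ (a + b)
    ...   | yes 2a≡a+b = a≢b (∙-cancelˡ a a b 2a≡a+b)
    ...   | no 2a≢a+b =
      no-ℬ₀-triangle (Q₂-shape ¬Ω₁a Ω₁[a+b] a+b≢0 a+b≢h₀ 2a≢a+b) y y a≢0 a+b≢0 (x≢x+y b≢0)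
        y∈B y+a∈B y+a+b∈B
        (∈block₀) (∈block₁ refl) (∈block₂ refl)
      where
      Ω₁[a+b] : Ω₁ G (a + b)
      Ω₁[a+b] = ≈-by-difference
        (solve 2 (λ a b → ((a :+ b) :+ (a :+ b)) :- :0 ⊜ (a :+ a) :- :- (b :+ b)) refl a b) 2a≡-2b

    ¬Ω₁a : ¬ Ω₁ G a
    ¬Ω₁a Ω₁a with (b + b) ≟ 0#
    ... | yes Ω₁b =
      no-ℬ₀-triangle (Q₃-shape Ω₁a a≢0 Ω₁b b≢0 a≢b) y y a≢0 b≢0 a≢b y∈B y+a∈B y+b∈B
        (∈block₀) (∈block₁ refl) (∈block₂ refl)
    ... | no ¬Ω₁b with a ≟ h₀
    ...   | yes a≡h₀ =
      no-ℬ₀-triangle (Q₁-shape ¬Ω₁b) y y b≢0 a≢0 (a≢b ∘ ≡.sym) y∈B y+b∈B y+a∈B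
        (∈block₀) (∈block₁ refl) (∈block₃ (cong (y +_) a≡h₀))
    ...   | no a≢h₀ with (b + b) ≟ a
    ...     | yes 2b≡a = a≢2b ¬Ω₁b (≡.sym 2b≡a)
    ...     | no 2b≢a =
      no-ℬ₀-triangle (Q₂-shape ¬Ω₁b Ω₁a a≢0 a≢h₀ 2b≢a) y y b≢0 a≢0 (a≢b ∘ ≡.sym)
        y∈B y+b∈B y+a∈B
        (∈block₀) (∈block₁ refl) (∈block₂ refl)

  module _ {y a b : Carrier} (P : Parallelogram y a b) where

    open Parallelogram P

    a≢±b : ¬ a ≡± b
    a≢±b (inj₁ a≡b)  = a≢b a≡b
    a≢±b (inj₂ a≡-b) = a+b≢0 (≡.trans (cong (_+ b) a≡-b) (inverseˡ b))

    ¬Ω₁b : ¬ Ω₁ G b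
    ¬Ω₁b = ¬Ω₁a (swap P)

    a≢±2b : ¬ a ≡± (b + b)
    a≢±2b (inj₁ a≡2b)  = a≢2b P ¬Ω₁b a≡2b
    a≢±2b (inj₂ a≡-2b) = a≢-2b P ¬Ω₁b a≡-2b

    b≢±2a : ¬ b ≡± (a + a)
    b≢±2a (inj₁ b≡2a)  = a≢2b (swap P) (¬Ω₁a P) b≡2a
    b≢±2a (inj₂ b≡-2a) = a≢-2b (swap P) (¬Ω₁a P) b≡-2a

    2a≢±2b : ¬ (a + a) ≡± (b + b)
    2a≢±2b (inj₁ 2a≡2b)  = 2a≢2b P ¬Ω₁b 2a≡2b
    2a≢±2b (inj₂ 2a≡-2b) = 2a≢-2b P (¬Ω₁a P) 2a≡-2b

    ±multiples-disjoint : ∀ {x} → x ∈ (a ∷ - a ∷ (a + a) ∷ - (a + a) ∷ []) →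
                          x ∈ (b ∷ - b ∷ (b + b) ∷ - (b + b) ∷ []) → ⊥
    ±multiples-disjoint x∈±a x∈±b with ∈±multiples x∈±a | ∈±multiples x∈±b
    ... | inj₁ x≡±a  | inj₁ x≡±b  = a≢±b (≡±-link x≡±a x≡±b)
    ... | inj₁ x≡±a  | inj₂ x≡±2b = a≢±2b (≡±-link x≡±a x≡±2b)
    ... | inj₂ x≡±2a | inj₁ x≡±b  = b≢±2a (≡±-link x≡±b x≡±2a)
    ... | inj₂ x≡±2a | inj₂ x≡±2b = 2a≢±2b (≡±-link x≡±2a x≡±2b)

    B≐parallelogram : _≐_ G B (⟪_⟫ G (block y (a ∷ b ∷ (a + b) ∷ [])))
    B≐parallelogram = enumeration⇒≐⟪⟫ B (Unique.map⁺ (∙-cancelˡ y _ _) offsets-distinct) (≡.sym ∣B∣≡4)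
      λ { _ (here refl) → InB-resp (identityʳ y) y∈B
        ; _ (there (here refl)) → y+a∈B
        ; _ (there (there (here refl))) → y+b∈B
        ; _ (there (there (there (here refl)))) → y+a+b∈B }
      where
      offsets-distinct : Unique (0# ∷ a ∷ b ∷ (a + b) ∷ [])
      offsets-distinct = (a≢0 ∘ ≡.sym ∷ b≢0 ∘ ≡.sym ∷ a+b≢0 ∘ ≡.sym ∷ [])
                       ∷ (a≢b ∷ x≢x+y b≢0 ∷ []) ∷ (y≢x+y a≢0 ∷ []) ∷ [] ∷ []

    parallelogram-orbit-in-ℰ : OrbitInℰ G B
    parallelogram-orbit-in-ℰ =
      a , b , ¬Ω₁a P , ¬Ω₁b
      , (λ x x∈±a → ¬-not (λ x∈±b → ±multiples-disjoint (∈⟪⟫⁻ _ x∈±a) (∈⟪⟫⁻ _ x∈±b)))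
      , OrbitIs-resp-≐ (a ∷ b ∷ (a + b) ∷ []) B≐parallelogram (OrbitIs-block y (a ∷ b ∷ (a + b) ∷ []))

  module _ (x : Carrier) (B≐x-B : _≐_ G B (translate G (negate G B) x)) where

    σ : Carrier → Carrier
    σ z = - (z - x)

    σ-preserves-B : ∀ {z} → InB z → InB (σ z)
    σ-preserves-B {z} z∈B = ≡.trans (≡.sym (B≐x-B z)) z∈B

    σ-involutive : ∀ z → σ (σ z) ≡ z
    σ-involutive z = solve 2 (λ z x → :- ((:- (z :- x)) :- x) ⊜ z) refl z x

    fixed-and-moved-point-excluded : ∀ {c z} → InB c → InB z → σ c ≡ c → σ z ≢ z → ⊥
    fixed-and-moved-point-excluded {c} {z} c∈B z∈B σc≡c σz≢z =
      no-ℬ₀-triangle (Q₁-shape ¬Ω₁d) c c (¬Ω₁⇒≢0 ¬Ω₁d) (¬Ω₁⇒-≢0 ¬Ω₁d) (¬Ω₁⇒≢- ¬Ω₁d)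
        c∈B (InB-resp (+-diff c z) z∈B) (InB-resp c-d≡σz (σ-preserves-B z∈B))
        ∈block₀ (∈block₁ refl) (∈block₂ refl)
      where
      d : Carrier
      d = z - c
      ¬Ω₁d : ¬ Ω₁ G d
      ¬Ω₁d Ω₁d = σz≢z (≈-by-difference₂
        (solve 3 (λ z c x → :- (z :- x) :- z ⊜ ((:- (c :- x)) :- c) :+ (:0 :- ((z :- c) :+ (z :- c))))
          refl z c x)
        σc≡c (≡.sym Ω₁d))
      c-d≡σz : c + - d ≡ σ z
      c-d≡σz = ≈-by-difference
        (solve 3 (λ z c x → (c :+ :- (z :- c)) :- :- (z :- x) ⊜ c :- :- (c :- x)) refl z c x)
        (≡.sym σc≡c)

    three-fixed-points-excluded : ∀ {p q r} → InB p → InB q → InB r →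
      σ p ≡ p → σ q ≡ q → σ r ≡ r → p ≢ q → p ≢ r → q ≢ r → ⊥
    three-fixed-points-excluded {p} {q} {r} p∈B q∈B r∈B σp≡p σq≡q σr≡r p≢q p≢r q≢r =
      no-ℬ₀-triangle (Q₃-shape (Ω₁-diff σq≡q) q-p≢0 (Ω₁-diff σr≡r) r-p≢0 q-p≢r-p) p p
        q-p≢0 r-p≢0 q-p≢r-p
        p∈B (InB-resp (+-diff p q) q∈B) (InB-resp (+-diff p r) r∈B)
        ∈block₀ (∈block₁ refl) (∈block₂ refl)
      where
      -- Fixed points of σ all satisfy 2z = x, so they differ by elements of Ω₁.
      Ω₁-diff : ∀ {z} → σ z ≡ z → Ω₁ G (z - p)
      Ω₁-diff {z} σz≡z = ≈-by-difference₂
        (solve 3 (λ z p x → ((z :- p) :+ (z :- p)) :- :0 ⊜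
                            ((:- (p :- x)) :- p) :+ (z :- :- (z :- x))) refl z p x)
        σp≡p (≡.sym σz≡z)
      q-p≢0 : q - p ≢ 0#
      q-p≢0 = p≢q ∘ ≡.sym ∘ diff≡0⇒≡
      r-p≢0 : r - p ≢ 0#
      r-p≢0 = p≢r ∘ ≡.sym ∘ diff≡0⇒≡
      q-p≢r-p : q - p ≢ r - p
      q-p≢r-p = q≢r ∘ ∙-cancelʳ (- p) q r

    σ-fixed-point-free : ∀ {p q r} → InB p → InB q → InB r → p ≢ q → p ≢ r → q ≢ r → σ p ≢ p
    σ-fixed-point-free {p} {q} {r} p∈B q∈B r∈B p≢q p≢r q≢r σp≡p
      with σ q ≟ q | σ r ≟ r
    ... | no σq≢q  | _         = fixed-and-moved-point-excluded p∈B q∈B σp≡p σq≢q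
    ... | yes _    | no σr≢r   = fixed-and-moved-point-excluded p∈B r∈B σp≡p σr≢r
    ... | yes σq≡q | yes σr≡r =
      three-fixed-points-excluded p∈B q∈B r∈B σp≡p σq≡q σr≡r p≢q p≢r q≢r

    -- p, w, σ w, σ p is the parallelogram y, y + a, y + b, y + (a + b).
    moved-pair-parallelogram : ∀ {p w} → InB p → InB w → σ p ≢ p → σ w ≢ w → w ≢ p → w ≢ σ p →
                               Parallelogram p (w - p) (σ w - p)
    moved-pair-parallelogram {p} {w} p∈B w∈B σp≢p σw≢w w≢p w≢σp = record
      { a≢0     = w≢p ∘ diff≡0⇒≡
      ; b≢0     = λ σw-p≡0 → w≢σp (≡.trans (≡.sym (σ-involutive w)) (cong σ (diff≡0⇒≡ σw-p≡0)))
      ; a≢b     = λ w-p≡σw-p → σw≢w (≡.sym (∙-cancelʳ (- p) w (σ w) w-p≡σw-p))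
      ; a+b≢0   = λ a+b≡0 → σp≢p (≈-by-difference
          (solve 3 (λ p w x → (:- (p :- x)) :- p ⊜ ((w :- p) :+ ((:- (w :- x)) :- p)) :- :0)
            refl p w x) a+b≡0)
      ; y∈B     = p∈B
      ; y+a∈B   = InB-resp (+-diff p w) w∈B
      ; y+b∈B   = InB-resp (+-diff p (σ w)) (σ-preserves-B w∈B)
      ; y+a+b∈B = InB-resp
          (solve 3 (λ p w x → p :+ ((w :- p) :+ ((:- (w :- x)) :- p)) ⊜ :- (p :- x)) refl p w x)
          (σ-preserves-B p∈B)
      }

    parallelogram-from-three-points : ∀ {p q r} → InB p → InB q → InB r →
      p ≢ q → p ≢ r → q ≢ r → ∃[ y ] ∃[ a ] ∃[ b ] Parallelogram y a b
    parallelogram-from-three-points {p} {q} {r} p∈B q∈B r∈B p≢q p≢r q≢r = from-choice (q ≟ σ p)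
      where
      σp≢p : σ p ≢ p
      σp≢p = σ-fixed-point-free p∈B q∈B r∈B p≢q p≢r q≢r
      from-choice : Dec (q ≡ σ p) → ∃[ y ] ∃[ a ] ∃[ b ] Parallelogram y a b
      from-choice (yes q≡σp) = _ , _ , _ , moved-pair-parallelogram p∈B r∈B σp≢p
        (σ-fixed-point-free r∈B p∈B q∈B (p≢r ∘ ≡.sym) (q≢r ∘ ≡.sym) p≢q)
        (p≢r ∘ ≡.sym) (λ r≡σp → q≢r (≡.trans q≡σp (≡.sym r≡σp)))
      from-choice (no q≢σp) = _ , _ , _ , moved-pair-parallelogram p∈B q∈B σp≢p
        (σ-fixed-point-free q∈B p∈B r∈B (p≢q ∘ ≡.sym) q≢r p≢r)
        (p≢q ∘ ≡.sym) q≢σp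

  B-parallelogram : ∃[ y ] ∃[ a ] ∃[ b ] Parallelogram y a b
  B-parallelogram with proj₁ (proj₂ reversible) B 𝓑B
  ... | x , B≐x-B = from-members (members B) (members-unique B) ∣B∣≡4 ∈-members⁻
    where
    from-members : ∀ zs → Unique zs → length zs ≡ 4 → (∀ {z} → z ∈ zs → InB z) →
                   ∃[ y ] ∃[ a ] ∃[ b ] Parallelogram y a b
    from-members (p ∷ q ∷ r ∷ _ ∷ []) ((p≢q ∷ p≢r ∷ _) ∷ (q≢r ∷ _) ∷ _) refl zs⊆B =
      parallelogram-from-three-points x B≐x-B (zs⊆B (here refl)) (zs⊆B (there (here refl)))
        (zs⊆B (there (there (here refl)))) p≢q p≢r q≢r

  orbit-in-ℰ : OrbitInℰ G B
  orbit-in-ℰ = parallelogram-orbit-in-ℰ (proj₂ (proj₂ (proj₂ B-parallelogram)))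

lemma5p2 : (v : ℕ) (G : FinAbGroup v)
    → (v % 6 ≡ 2 ⊎ v % 6 ≡ 4)
    → (h₀ : FinAbGroup.Carrier G)
    → h₀ ≢ FinAbGroup.0# G
    → FinAbGroup._+_ G h₀ h₀ ≡ FinAbGroup.0# G
    → (𝓑 : Family G)
    → IsReversibleSQS G 𝓑
    → (∀ S → ℬ₀ G h₀ S → _∈F_ G S 𝓑)
    → ∀ B → 𝓑 B → ¬ (ℬ₀ G h₀ B)
    → OrbitInℰ G B
-- The congruence on v only guarantees that an SQS(v) exists; the argument does not use it.
lemma5p2 v G _ h₀ h₀≢0 Ω₁h₀ 𝓑 reversible ℬ₀⊆𝓑 B 𝓑B B∉ℬ₀ =
  NonBaseBlock.orbit-in-ℰ G h₀ h₀≢0 Ω₁h₀ 𝓑 reversible ℬ₀⊆𝓑 B 𝓑B B∉ℬ₀
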